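{- Let $\mathfrak{C}=\langle\mathsf{C},\preceq\rangle$ be a classical case model all of whose formulas are built using only $\neg,\wedge,\vee$, and let $\mathfrak{C}_{\mathsf{BD}\triangle}=\langle\mathsf{C}_{\mathsf{BD}\triangle},\preceq_{\mathsf{BD}\triangle}\rangle$ be its $\mathsf{BD}\triangle$ counterpart. Then: (1) $\mathfrak{C}_{\mathsf{BD}\triangle}$ is a quasi-classical $\mathsf{BD}\triangle$ case model; (2) for all formulas $\phi,\chi$ built from variables using only $\neg,\wedge,\vee$, the argument $\langle\phi,\chi\rangle$ is classically coherent (resp. classically presumptively valid, classically conclusive) over $\mathfrak{C}$ iff $\langle\phi^\mathbf{t},\chi^\mathbf{t}\rangle$ is strongly coherent (resp. strongly presumptively valid, strongly conclusive) over $\mathfrak{C}_{\mathsf{BD}\triangle}$.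
   Context: Classical side: $\models_{\mathsf{CPL}}$ is classical propositional entailment. A classical case model is $\langle\mathsf{C},\preceq\rangle$ with $\mathsf{C}$ a finite set of classically satisfiable formulas such that any two distinct elements have classically unsatisfiable conjunction, and $\preceq$ a total preorder on $\mathsf{C}$. An argument $\langle\phi,\chi\rangle$ is classically coherent iff some $\psi\in\mathsf{C}$ has $\psi\models_{\mathsf{CPL}}\phi\wedge\chi$; classically conclusive iff it is classically coherent and every $\psi\in\mathsf{C}$ with $\psi\models_{\mathsf{CPL}}\phi$ has $\psi\models_{\mathsf{CPL}}\phi\wedge\chi$; classically presumptively valid iff there is $\psi\in\mathsf{C}$ with $\psi\models_{\mathsf{CPL}}\phi\wedge\chi$ and $\psi\succeq\psi'$ for every $\psi'\in\mathsf{C}$ with $\psi'\models_{\mathsf{CPL}}\phi$. $\mathsf{BD}\triangle$ side: $\mathscr{L}_{\mathsf{BD}\triangle}$ consists of formulas built from a countable set $\mathtt{Prop}$ of variables by $\neg,\wedge,\vee,\triangle$. A $\mathsf{BD}\triangle$ model is $\langle W,v^+,v^-\rangle$ with $v^+,v^-:\mathtt{Prop}\to2^W$; at $w\in W$: $w\vDash^\pm p$ iff $w\in v^\pm(p)$; $w\vDash^+\neg\phi$ iff $w\vDash^-\phi$, $w\vDash^-\neg\phi$ iff $w\vDash^+\phi$; $w\vDash^+\phi\wedge\phi'$ iff both $w\vDash^+\phi,w\vDash^+\phi'$, $w\vDash^-\phi\wedge\phi'$ iff $w\vDash^-\phi$ or $w\vDash^-\phi'$; $w\vDash^+\phi\vee\phi'$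 iff $w\vDash^+\phi$ or $w\vDash^+\phi'$, $w\vDash^-\phi\vee\phi'$ iff both $w\vDash^-\phi,w\vDash^-\phi'$; $w\vDash^+\triangle\phi$ iff $w\vDash^+\phi$, $w\vDash^-\triangle\phi$ iff $w\nvDash^+\phi$. With $|\phi|^\pm=\{w:w\vDash^\pm\phi\}$, $\phi\models_{\mathsf{BD}\triangle}\chi$ iff in every model $|\phi|^+\subseteq|\chi|^+$ and $|\chi|^-\subseteq|\phi|^-$. Abbreviations: $\mathbf{t}(\phi)=\triangle\phi\wedge\neg\triangle\neg\phi$; $\top=\triangle p\vee\neg\triangle p$ for a fixed variable $p$; $\bot=\neg\top$. A $\mathsf{BD}\triangle$ case model is $\langle\mathsf{C},\preceq\rangle$ with $\mathsf{C}$ a finite set of formulas with $\psi\not\models_{\mathsf{BD}\triangle}\bot$ for all $\psi\in\mathsf{C}$ and $\psi\wedge\psi'\models_{\mathsf{BD}\triangle}\bot$ for distinct $\psi,\psi'\in\mathsf{C}$, and $\preceq$ a total preorder; it is quasi-classical iff every element of $\mathsf{C}$ is built from formulas $\mathbf{t}(p)$ using only $\neg,\wedge,\vee$. An argument $\langle\phi,\chi\rangle$ is strongly coherent iff some $\psi\in\mathsf{C}$ has $\psi\models_{\mathsf{BD}\triangle}\phi\wedge\mathbf{t}(\chi)$; strongly conclusive iff it is strongly coherent and every $\psi\in\mathsf{C}$ with $\psi\models_{\mathsf{BD}\triangle}\phi$ has $\psi\models_{\mathsf{BD}\triangle}\phi\wedge\mathbf{t}(\chi)$; strongly presumptively valid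 iff some $\psi\in\mathsf{C}$ has $\psi\models_{\mathsf{BD}\triangle}\phi\wedge\mathbf{t}(\chi)$ and $\psi\succeq\psi'$ for all $\psi'\in\mathsf{C}$ with $\psi'\models_{\mathsf{BD}\triangle}\phi$. Translation: for a formula $\phi$ over $\neg,\wedge,\vee$, $\phi^\mathbf{t}$ is obtained by replacing every variable $p$ in $\phi$ by $\mathbf{t}(p)$. The $\mathsf{BD}\triangle$ counterpart of $\mathfrak{C}$ is $\langle\{\chi^\mathbf{t}:\chi\in\mathsf{C}\},\preceq_{\mathsf{BD}\triangle}\rangle$ with $\chi^\mathbf{t}\preceq_{\mathsf{BD}\triangle}{\chi'}^\mathbf{t}$ iff $\chi\preceq\chi'$. -}

module Defs where

open import Data.Nat using (ℕ)
open import Data.Bool using (Bool; true; false; not; _∧_; _∨_)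
open import Data.List using (List; map)
open import Data.List.Membership.Propositional using (_∈_)
open import Data.Product using (Σ; ∃; _×_; _,_)
open import Data.Sum using (_⊎_)
open import Relation.Nullary using (¬_)
open import Relation.Binary.PropositionalEquality using (_≡_; _≢_)
open import Level using (0ℓ)

data CFm : Set where
  cvar  : ℕ → CFm
  c¬    : CFm → CFm
  _c∧_  : CFm → CFm → CFm
  _c∨_  : CFm → CFm → CFm

ceval : (ℕ → Bool) → CFm → Bool
ceval v (cvar p)  = v p
ceval v (c¬ φ)    = not (ceval v φ)
ceval v (φ c∧ ψ)  = ceval v φ ∧ ceval v ψ
ceval v (φ c∨ ψ)  = ceval v φ ∨ ceval v ψ

_⊨CPL_ : CFm → CFm → Set
φ ⊨CPL χ = (v : ℕ → Bool) → ceval v φ ≡ true → ceval v χ ≡ true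

CSat : CFm → Set
CSat φ = Σ (ℕ → Bool) λ v → ceval v φ ≡ true

-- classical case model ⟨C, ≼⟩ ; the finite set C is given as a list,
-- ≼ is a relation on formulas required to be a total preorder on C.
record IsClassicalCaseModel (C : List CFm) (_≼_ : CFm → CFm → Set) : Set where
  field
    sat      : ∀ {ψ} → ψ ∈ C → CSat ψ
    disjoint : ∀ {ψ ψ'} → ψ ∈ C → ψ' ∈ C → ψ ≢ ψ' → ¬ CSat (ψ c∧ ψ')
    refl≼    : ∀ {ψ} → ψ ∈ C → ψ ≼ ψ
    trans≼   : ∀ {ψ ψ' ψ''} → ψ ∈ C → ψ' ∈ C → ψ'' ∈ C →
               ψ ≼ ψ' → ψ' ≼ ψ'' → ψ ≼ ψ''
    total≼   : ∀ {ψ ψ'} → ψ ∈ C → ψ' ∈ C → (ψ ≼ ψ') ⊎ (ψ' ≼ ψ)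

module _ (C : List CFm) (_≼_ : CFm → CFm → Set) where
  ClassicallyCoherent : CFm → CFm → Set
  ClassicallyCoherent φ χ = Σ CFm λ ψ → ψ ∈ C × ψ ⊨CPL (φ c∧ χ)

  ClassicallyConclusive : CFm → CFm → Set
  ClassicallyConclusive φ χ =
    ClassicallyCoherent φ χ ×
    (∀ ψ → ψ ∈ C → ψ ⊨CPL φ → ψ ⊨CPL (φ c∧ χ))

  ClassicallyPresumptivelyValid : CFm → CFm → Set
  ClassicallyPresumptivelyValid φ χ =
    Σ CFm λ ψ → ψ ∈ C × ψ ⊨CPL (φ c∧ χ) ×
      (∀ ψ' → ψ' ∈ C → ψ' ⊨CPL φ → ψ' ≼ ψ)

data Fm : Set where
  var  : ℕ → Fm
  ¬'   : Fm → Fm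
  _∧'_ : Fm → Fm → Fm
  _∨'_ : Fm → Fm → Fm
  △    : Fm → Fm

-- A BD△ model ⟨W, v⁺, v⁻⟩ (subsets of W as Bool-valued predicates)
record Model : Set₁ where
  field
    W  : Set
    v⁺ : ℕ → W → Bool
    v⁻ : ℕ → W → Bool

module _ (M : Model) where
  open Model M
  mutual
    pos : W → Fm → Bool
    pos w (var p)   = v⁺ p w
    pos w (¬' φ)    = neg w φ
    pos w (φ ∧' ψ)  = pos w φ ∧ pos w ψ
    pos w (φ ∨' ψ)  = pos w φ ∨ pos w ψ
    pos w (△ φ)     = pos w φ

    neg : W → Fm → Bool
    neg w (var p)   = v⁻ p w
    neg w (¬' φ)    = pos w φ
    neg w (φ ∧' ψ)  = neg w φ ∨ neg w ψ
    neg w (φ ∨' ψ)  = neg w φ ∧ neg w ψ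
    neg w (△ φ)     = not (pos w φ)

_⊨BD_ : Fm → Fm → Set₁
φ ⊨BD χ = (M : Model) (w : Model.W M) →
  (pos M w φ ≡ true → pos M w χ ≡ true) ×
  (neg M w χ ≡ true → neg M w φ ≡ true)

𝐭 : Fm → Fm
𝐭 φ = △ φ ∧' ¬' (△ (¬' φ))

⊤' : Fm
⊤' = △ (var 0) ∨' ¬' (△ (var 0))

⊥' : Fm
⊥' = ¬' ⊤'

data QuasiClassicalFm : Fm → Set where
  qc-t : ∀ p → QuasiClassicalFm (𝐭 (var p))
  qc-¬ : ∀ {φ} → QuasiClassicalFm φ → QuasiClassicalFm (¬' φ)
  qc-∧ : ∀ {φ ψ} → QuasiClassicalFm φ → QuasiClassicalFm ψ → QuasiClassicalFm (φ ∧' ψ)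
  qc-∨ : ∀ {φ ψ} → QuasiClassicalFm φ → QuasiClassicalFm ψ → QuasiClassicalFm (φ ∨' ψ)

record IsBDCaseModel (C : List Fm) (_≼_ : Fm → Fm → Set) : Set₁ where
  field
    consistent : ∀ {ψ} → ψ ∈ C → ¬ (ψ ⊨BD ⊥')
    disjoint   : ∀ {ψ ψ'} → ψ ∈ C → ψ' ∈ C → ψ ≢ ψ' → (ψ ∧' ψ') ⊨BD ⊥'
    refl≼      : ∀ {ψ} → ψ ∈ C → ψ ≼ ψ
    trans≼     : ∀ {ψ ψ' ψ''} → ψ ∈ C → ψ' ∈ C → ψ'' ∈ C →
                 ψ ≼ ψ' → ψ' ≼ ψ'' → ψ ≼ ψ''
    total≼     : ∀ {ψ ψ'} → ψ ∈ C → ψ' ∈ C → (ψ ≼ ψ') ⊎ (ψ' ≼ ψ)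

record IsQuasiClassicalBDCaseModel (C : List Fm) (_≼_ : Fm → Fm → Set) : Set₁ where
  field
    caseModel      : IsBDCaseModel C _≼_
    quasiClassical : ∀ {ψ} → ψ ∈ C → QuasiClassicalFm ψ

module _ (C : List Fm) (_≼_ : Fm → Fm → Set) where
  StronglyCoherent : Fm → Fm → Set₁
  StronglyCoherent φ χ = Σ Fm λ ψ → ψ ∈ C × ψ ⊨BD (φ ∧' 𝐭 χ)

  StronglyConclusive : Fm → Fm → Set₁
  StronglyConclusive φ χ =
    StronglyCoherent φ χ ×
    (∀ ψ → ψ ∈ C → ψ ⊨BD φ → ψ ⊨BD (φ ∧' 𝐭 χ))

  StronglyPresumptivelyValid : Fm → Fm → Set₁
  StronglyPresumptivelyValid φ χ =
    Σ Fm λ ψ → ψ ∈ C × ψ ⊨BD (φ ∧' 𝐭 χ) ×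
      (∀ ψ' → ψ' ∈ C → ψ' ⊨BD φ → ψ' ≼ ψ)

_ᵗ : CFm → Fm
cvar p ᵗ   = 𝐭 (var p)
c¬ φ ᵗ     = ¬' (φ ᵗ)
(φ c∧ ψ) ᵗ = (φ ᵗ) ∧' (ψ ᵗ)
(φ c∨ ψ) ᵗ = (φ ᵗ) ∨' (ψ ᵗ)

counterpartC : List CFm → List Fm
counterpartC C = map _ᵗ C

-- χᵗ ≼_BD χ'ᵗ iff χ ≼ χ'  (for χ, χ' ∈ C)
counterpart≼ : List CFm → (CFm → CFm → Set) → Fm → Fm → Set
counterpart≼ C _≼_ ψ ψ' =
  Σ CFm λ χ → Σ CFm λ χ' →
    χ ∈ C × χ' ∈ C × ψ ≡ χ ᵗ × ψ' ≡ χ' ᵗ × χ ≼ χ'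

record _⇔_ {a b} (A : Set a) (B : Set b) : Set (Level._⊔_ a b) where
  constructor mk⇔
  field
    to   : A → B
    from : B → A

-- Every world w of a BD△ model induces the classical valuation p ↦ (w ⊨⁺ 𝐭 p). A translated
-- formula φᵗ is classical with respect to it: w ⊨⁺ φᵗ iff φ is true and w ⊨⁻ φᵗ iff φ is false.
-- So BD△ entailment between translations is classical entailment: one direction reads the
-- valuation off an arbitrary world, the other realises a valuation as a one-world model. Since
-- ⊥' is classical as well, satisfiability and pairwise exclusivity transfer; since ᵗ is
-- injective, the preorder transfers; and each argument notion over the counterpart is then the
-- classical one read through ᵗ.

module Submission where

open import Defs
open import Data.Bool using (Bool; true; false; not; _∧_; _∨_)
open import Data.Bool.Properties
  using (∧-comm; ∧-idem; ∧-inverseˡ; ∧-inverseʳ; ∨-comm; ∨-inverseʳ; ∨-idem;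
         not-involutive; ∨-∧-booleanAlgebra)
open import Algebra.Lattice.Properties.BooleanAlgebra ∨-∧-booleanAlgebra
  using (deMorgan₁; deMorgan₂)
open import Data.Empty using (⊥-elim)
open import Data.List using (List)
open import Data.List.Membership.Propositional using (_∈_)
open import Data.List.Membership.Propositional.Properties using (∈-map⁺; ∈-map⁻)
open import Data.Nat using (ℕ)
open import Data.Product using (_×_; _,_; proj₁)
open import Data.Sum using (_⊎_; inj₁; inj₂)
open import Data.Unit using (⊤; tt)
open import Relation.Nullary using (¬_)
open import Relation.Binary.PropositionalEquality
  using (_≡_; _≢_; refl; sym; trans; cong; cong₂; module ≡-Reasoning)

open _⇔_

-- Conjuncts ordered so that on `pointModel v` below this is definitionally v.
𝐭-valuation : (M : Model) → Model.W M → ℕ → Bool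
𝐭-valuation M w p = not (Model.v⁻ M p w) ∧ Model.v⁺ M p w

pointModel : (ℕ → Bool) → Model
pointModel v = record { W = ⊤ ; v⁺ = λ p _ → v p ; v⁻ = λ _ _ → false }

record Represents (A : Fm) (a : CFm) : Set₁ where
  field
    pos-≡ : ∀ M w → pos M w A ≡ ceval (𝐭-valuation M w) a
    neg-≡ : ∀ M w → neg M w A ≡ not (ceval (𝐭-valuation M w) a)

open Represents

𝐭-var-represents : ∀ p → Represents (𝐭 (var p)) (cvar p)
pos-≡ (𝐭-var-represents p) M w = ∧-comm (Model.v⁺ M p w) (not (Model.v⁻ M p w))
neg-≡ (𝐭-var-represents p) M w = begin
  not v⁺ ∨ v⁻             ≡⟨ ∨-comm (not v⁺) v⁻ ⟩
  v⁻ ∨ not v⁺             ≡⟨ cong (_∨ not v⁺) (sym (not-involutive v⁻)) ⟩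
  not (not v⁻) ∨ not v⁺   ≡⟨ sym (deMorgan₁ (not v⁻) v⁺) ⟩
  not (not v⁻ ∧ v⁺)       ∎
  where
  open ≡-Reasoning
  v⁺ v⁻ : Bool
  v⁺ = Model.v⁺ M p w
  v⁻ = Model.v⁻ M p w

module _ {A : Fm} {a : CFm} (A≈a : Represents A a) where

  ¬-represents : Represents (¬' A) (c¬ a)
  pos-≡ ¬-represents = neg-≡ A≈a
  neg-≡ ¬-represents M w = trans (pos-≡ A≈a M w) (sym (not-involutive _))

  𝐭-represents : Represents (𝐭 A) a
  pos-≡ 𝐭-represents M w =
    trans (cong₂ (λ x y → x ∧ not y) (pos-≡ A≈a M w) (neg-≡ A≈a M w))
          (trans (cong (x ∧_) (not-involutive x)) (∧-idem x))
    where x = ceval (𝐭-valuation M w) a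
  neg-≡ 𝐭-represents M w =
    trans (cong₂ (λ x y → not x ∨ y) (pos-≡ A≈a M w) (neg-≡ A≈a M w)) (∨-idem _)

module _ {A B : Fm} {a b : CFm} (A≈a : Represents A a) (B≈b : Represents B b) where

  ∧-represents : Represents (A ∧' B) (a c∧ b)
  pos-≡ ∧-represents M w = cong₂ _∧_ (pos-≡ A≈a M w) (pos-≡ B≈b M w)
  neg-≡ ∧-represents M w =
    trans (cong₂ _∨_ (neg-≡ A≈a M w) (neg-≡ B≈b M w)) (sym (deMorgan₁ (ceval v a) (ceval v b)))
    where v = 𝐭-valuation M w

  ∨-represents : Represents (A ∨' B) (a c∨ b)
  pos-≡ ∨-represents M w = cong₂ _∨_ (pos-≡ A≈a M w) (pos-≡ B≈b M w)
  neg-≡ ∨-represents M w =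
    trans (cong₂ _∧_ (neg-≡ A≈a M w) (neg-≡ B≈b M w)) (sym (deMorgan₂ (ceval v a) (ceval v b)))
    where v = 𝐭-valuation M w

ᵗ-represents : ∀ φ → Represents (φ ᵗ) φ
ᵗ-represents (cvar p)  = 𝐭-var-represents p
ᵗ-represents (c¬ φ)    = ¬-represents (ᵗ-represents φ)
ᵗ-represents (φ c∧ ψ)  = ∧-represents (ᵗ-represents φ) (ᵗ-represents ψ)
ᵗ-represents (φ c∨ ψ)  = ∨-represents (ᵗ-represents φ) (ᵗ-represents ψ)

⊥ᶜ : CFm
⊥ᶜ = cvar 0 c∧ c¬ (cvar 0)

⊥'-represents : Represents ⊥' ⊥ᶜ
pos-≡ ⊥'-represents M w =
  trans (∧-inverseˡ (Model.v⁺ M 0 w)) (sym (∧-inverseʳ (𝐭-valuation M w 0)))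
neg-≡ ⊥'-represents M w =
  trans (∨-inverseʳ (Model.v⁺ M 0 w)) (sym (cong not (∧-inverseʳ (𝐭-valuation M w 0))))

contraposeᵇ : ∀ {x y} → (x ≡ true → y ≡ true) → not y ≡ true → not x ≡ true
contraposeᵇ {false} _   _    = refl
contraposeᵇ {true}  x⇒y ¬y with x⇒y refl
... | refl = ¬y

module _ {A B : Fm} {a b : CFm} (A≈a : Represents A a) (B≈b : Represents B b) where

  ⊨CPL⇒⊨BD : a ⊨CPL b → A ⊨BD B
  ⊨CPL⇒⊨BD a⊨b M w = preserves-pos , reflects-neg
    where
    a⇒b : ceval (𝐭-valuation M w) a ≡ true → ceval (𝐭-valuation M w) b ≡ true
    a⇒b = a⊨b (𝐭-valuation M w)
    preserves-pos : pos M w A ≡ true → pos M w B ≡ true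
    preserves-pos A⁺ = trans (pos-≡ B≈b M w) (a⇒b (trans (sym (pos-≡ A≈a M w)) A⁺))
    reflects-neg : neg M w B ≡ true → neg M w A ≡ true
    reflects-neg B⁻ =
      trans (neg-≡ A≈a M w) (contraposeᵇ a⇒b (trans (sym (neg-≡ B≈b M w)) B⁻))

  ⊨BD⇒⊨CPL : A ⊨BD B → a ⊨CPL b
  ⊨BD⇒⊨CPL A⊨B v a-true =
    trans (sym (pos-≡ B≈b (pointModel v) tt))
          (proj₁ (A⊨B (pointModel v) tt) (trans (pos-≡ A≈a (pointModel v) tt) a-true))

  ⊨BD⇔⊨CPL : (A ⊨BD B) ⇔ (a ⊨CPL b)
  ⊨BD⇔⊨CPL = mk⇔ ⊨BD⇒⊨CPL ⊨CPL⇒⊨BD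

ᵗ-consistent : ∀ x → CSat x → ¬ ((x ᵗ) ⊨BD ⊥')
ᵗ-consistent x (v , x-true) x⊨⊥ with
  trans (sym (∧-inverseʳ (v 0))) (⊨BD⇒⊨CPL (ᵗ-represents x) ⊥'-represents x⊨⊥ v x-true)
... | ()

ᵗ-exclusive : ∀ x y → ¬ CSat (x c∧ y) → ((x ᵗ) ∧' (y ᵗ)) ⊨BD ⊥'
ᵗ-exclusive x y unsat =
  ⊨CPL⇒⊨BD (ᵗ-represents (x c∧ y)) ⊥'-represents (λ v x∧y → ⊥-elim (unsat (v , x∧y)))

ᵗ-quasiClassical : ∀ φ → QuasiClassicalFm (φ ᵗ)
ᵗ-quasiClassical (cvar p)  = qc-t p
ᵗ-quasiClassical (c¬ φ)    = qc-¬ (ᵗ-quasiClassical φ)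
ᵗ-quasiClassical (φ c∧ ψ)  = qc-∧ (ᵗ-quasiClassical φ) (ᵗ-quasiClassical ψ)
ᵗ-quasiClassical (φ c∨ ψ)  = qc-∨ (ᵗ-quasiClassical φ) (ᵗ-quasiClassical ψ)

untranslate : Fm → CFm
untranslate (△ (var p) ∧' _) = cvar p
untranslate (¬' A)           = c¬ (untranslate A)
untranslate (A ∧' B)         = untranslate A c∧ untranslate B
untranslate (A ∨' B)         = untranslate A c∨ untranslate B
untranslate _                = cvar 0

untranslate-ᵗ∧ : ∀ φ B → untranslate ((φ ᵗ) ∧' B) ≡ untranslate (φ ᵗ) c∧ untranslate B
untranslate-ᵗ∧ (cvar p)  B = refl
untranslate-ᵗ∧ (c¬ φ)    B = refl
untranslate-ᵗ∧ (φ c∧ ψ)  B = refl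
untranslate-ᵗ∧ (φ c∨ ψ)  B = refl

untranslate-ᵗ : ∀ φ → untranslate (φ ᵗ) ≡ φ
untranslate-ᵗ (cvar p)  = refl
untranslate-ᵗ (c¬ φ)    = cong c¬ (untranslate-ᵗ φ)
untranslate-ᵗ (φ c∧ ψ)  =
  trans (untranslate-ᵗ∧ φ (ψ ᵗ)) (cong₂ _c∧_ (untranslate-ᵗ φ) (untranslate-ᵗ ψ))
untranslate-ᵗ (φ c∨ ψ)  = cong₂ _c∨_ (untranslate-ᵗ φ) (untranslate-ᵗ ψ)

ᵗ-injective : ∀ {φ ψ} → φ ᵗ ≡ ψ ᵗ → φ ≡ ψ
ᵗ-injective {φ} {ψ} eq =
  trans (sym (untranslate-ᵗ φ)) (trans (cong untranslate eq) (untranslate-ᵗ ψ))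

module _ (C : List CFm) (_≼_ : CFm → CFm → Set) where

  counterpart≼-ᵗ : ∀ {x y} → x ∈ C → y ∈ C → counterpart≼ C _≼_ (x ᵗ) (y ᵗ) ⇔ (x ≼ y)
  counterpart≼-ᵗ {x} {y} x∈C y∈C = mk⇔ reflect (λ x≼y → x , y , x∈C , y∈C , refl , refl , x≼y)
    where
    reflect : counterpart≼ C _≼_ (x ᵗ) (y ᵗ) → x ≼ y
    reflect (_ , _ , _ , _ , eqˣ , eqʸ , x'≼y') with ᵗ-injective eqˣ | ᵗ-injective eqʸ
    ... | refl | refl = x'≼y'

  counterpart-isQuasiClassical : IsClassicalCaseModel C _≼_ →
                                 IsQuasiClassicalBDCaseModel (counterpartC C) (counterpart≼ C _≼_)
  counterpart-isQuasiClassical CM = record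
    { caseModel = record
      { consistent = consistent
      ; disjoint   = exclusive
      ; refl≼      = reflexive
      ; trans≼     = transitive
      ; total≼     = total
      }
    ; quasiClassical = quasiClassical
    }
    where
    open IsClassicalCaseModel CM
    C' : List Fm
    C' = counterpartC C
    _≼'_ : Fm → Fm → Set
    _≼'_ = counterpart≼ C _≼_

    consistent : ∀ {ψ} → ψ ∈ C' → ¬ (ψ ⊨BD ⊥')
    consistent ψ∈ with ∈-map⁻ _ᵗ ψ∈
    ... | x , x∈C , refl = ᵗ-consistent x (sat x∈C)

    quasiClassical : ∀ {ψ} → ψ ∈ C' → QuasiClassicalFm ψ
    quasiClassical ψ∈ with ∈-map⁻ _ᵗ ψ∈
    ... | x , _ , refl = ᵗ-quasiClassical x

    reflexive : ∀ {ψ} → ψ ∈ C' → ψ ≼' ψ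
    reflexive ψ∈ with ∈-map⁻ _ᵗ ψ∈
    ... | x , x∈C , refl = from (counterpart≼-ᵗ x∈C x∈C) (refl≼ x∈C)

    exclusive : ∀ {ψ ψ'} → ψ ∈ C' → ψ' ∈ C' → ψ ≢ ψ' → (ψ ∧' ψ') ⊨BD ⊥'
    exclusive ψ∈ ψ'∈ ψ≢ψ' with ∈-map⁻ _ᵗ ψ∈ | ∈-map⁻ _ᵗ ψ'∈
    ... | x , x∈C , refl | y , y∈C , refl =
      ᵗ-exclusive x y (disjoint x∈C y∈C (λ x≡y → ψ≢ψ' (cong _ᵗ x≡y)))

    transitive : ∀ {ψ ψ' ψ''} → ψ ∈ C' → ψ' ∈ C' → ψ'' ∈ C' →
                 ψ ≼' ψ' → ψ' ≼' ψ'' → ψ ≼' ψ''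
    transitive ψ∈ ψ'∈ ψ''∈ with ∈-map⁻ _ᵗ ψ∈ | ∈-map⁻ _ᵗ ψ'∈ | ∈-map⁻ _ᵗ ψ''∈
    ... | x , x∈C , refl | y , y∈C , refl | z , z∈C , refl = λ x≼y y≼z →
      from (counterpart≼-ᵗ x∈C z∈C)
        (trans≼ x∈C y∈C z∈C (to (counterpart≼-ᵗ x∈C y∈C) x≼y) (to (counterpart≼-ᵗ y∈C z∈C) y≼z))

    total : ∀ {ψ ψ'} → ψ ∈ C' → ψ' ∈ C' → (ψ ≼' ψ') ⊎ (ψ' ≼' ψ)
    total ψ∈ ψ'∈ with ∈-map⁻ _ᵗ ψ∈ | ∈-map⁻ _ᵗ ψ'∈
    ... | x , x∈C , refl | y , y∈C , refl with total≼ x∈C y∈C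
    ... | inj₁ x≼y = inj₁ (from (counterpart≼-ᵗ x∈C y∈C) x≼y)
    ... | inj₂ y≼x = inj₂ (from (counterpart≼-ᵗ y∈C x∈C) y≼x)

ᵗ-⊨ᵗ : ∀ x φ → ((x ᵗ) ⊨BD (φ ᵗ)) ⇔ (x ⊨CPL φ)
ᵗ-⊨ᵗ x φ = ⊨BD⇔⊨CPL (ᵗ-represents x) (ᵗ-represents φ)

ᵗ-⊨ᵗ∧𝐭ᵗ : ∀ x φ χ → ((x ᵗ) ⊨BD ((φ ᵗ) ∧' 𝐭 (χ ᵗ))) ⇔ (x ⊨CPL (φ c∧ χ))
ᵗ-⊨ᵗ∧𝐭ᵗ x φ χ =
  ⊨BD⇔⊨CPL (ᵗ-represents x) (∧-represents (ᵗ-represents φ) (𝐭-represents (ᵗ-represents χ)))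

module _ (C : List CFm) (_≼_ : CFm → CFm → Set) (φ χ : CFm) where

  private
    C' : List Fm
    C' = counterpartC C
    _≼'_ : Fm → Fm → Set
    _≼'_ = counterpart≼ C _≼_

  coherent⇔stronglyCoherent :
    ClassicallyCoherent C _≼_ φ χ ⇔ StronglyCoherent C' _≼'_ (φ ᵗ) (χ ᵗ)
  coherent⇔stronglyCoherent = mk⇔
    (λ (x , x∈C , x⊨) → x ᵗ , ∈-map⁺ _ᵗ x∈C , from (ᵗ-⊨ᵗ∧𝐭ᵗ x φ χ) x⊨)
    reflect
    where
    reflect : StronglyCoherent C' _≼'_ (φ ᵗ) (χ ᵗ) → ClassicallyCoherent C _≼_ φ χ
    reflect (ψ , ψ∈ , ψ⊨) with ∈-map⁻ _ᵗ ψ∈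
    ... | x , x∈C , refl = x , x∈C , to (ᵗ-⊨ᵗ∧𝐭ᵗ x φ χ) ψ⊨

  presumptivelyValid⇔stronglyPresumptivelyValid :
    ClassicallyPresumptivelyValid C _≼_ φ χ ⇔ StronglyPresumptivelyValid C' _≼'_ (φ ᵗ) (χ ᵗ)
  presumptivelyValid⇔stronglyPresumptivelyValid = mk⇔ preserve reflect
    where
    preserve : ClassicallyPresumptivelyValid C _≼_ φ χ →
               StronglyPresumptivelyValid C' _≼'_ (φ ᵗ) (χ ᵗ)
    preserve (x , x∈C , x⊨ , x-maximal) =
      x ᵗ , ∈-map⁺ _ᵗ x∈C , from (ᵗ-⊨ᵗ∧𝐭ᵗ x φ χ) x⊨ , maximal
      where
      maximal : ∀ ψ → ψ ∈ C' → ψ ⊨BD (φ ᵗ) → ψ ≼' (x ᵗ)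
      maximal ψ ψ∈ ψ⊨ with ∈-map⁻ _ᵗ ψ∈
      ... | y , y∈C , refl =
        from (counterpart≼-ᵗ C _≼_ y∈C x∈C) (x-maximal y y∈C (to (ᵗ-⊨ᵗ y φ) ψ⊨))

    reflect : StronglyPresumptivelyValid C' _≼'_ (φ ᵗ) (χ ᵗ) →
              ClassicallyPresumptivelyValid C _≼_ φ χ
    reflect (ψ , ψ∈ , ψ⊨ , ψ-maximal) with ∈-map⁻ _ᵗ ψ∈
    ... | x , x∈C , refl = x , x∈C , to (ᵗ-⊨ᵗ∧𝐭ᵗ x φ χ) ψ⊨ , λ y y∈C y⊨ →
      to (counterpart≼-ᵗ C _≼_ y∈C x∈C)
         (ψ-maximal (y ᵗ) (∈-map⁺ _ᵗ y∈C) (from (ᵗ-⊨ᵗ y φ) y⊨))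

  conclusive⇔stronglyConclusive :
    ClassicallyConclusive C _≼_ φ χ ⇔ StronglyConclusive C' _≼'_ (φ ᵗ) (χ ᵗ)
  conclusive⇔stronglyConclusive = mk⇔
    (λ (coherent , conclusive) →
       to coherent⇔stronglyCoherent coherent , preserve conclusive)
    (λ (coherent , conclusive) →
       from coherent⇔stronglyCoherent coherent , λ y y∈C y⊨ →
         to (ᵗ-⊨ᵗ∧𝐭ᵗ y φ χ) (conclusive (y ᵗ) (∈-map⁺ _ᵗ y∈C) (from (ᵗ-⊨ᵗ y φ) y⊨)))
    where
    preserve : (∀ x → x ∈ C → x ⊨CPL φ → x ⊨CPL (φ c∧ χ)) →
               ∀ ψ → ψ ∈ C' → ψ ⊨BD (φ ᵗ) → ψ ⊨BD ((φ ᵗ) ∧' 𝐭 (χ ᵗ))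
    preserve conclusive ψ ψ∈ ψ⊨ with ∈-map⁻ _ᵗ ψ∈
    ... | x , x∈C , refl = from (ᵗ-⊨ᵗ∧𝐭ᵗ x φ χ) (conclusive x x∈C (to (ᵗ-⊨ᵗ x φ) ψ⊨))

theorem1 : (C : List CFm) (_≼_ : CFm → CFm → Set) →
    IsClassicalCaseModel C _≼_ →
    IsQuasiClassicalBDCaseModel (counterpartC C) (counterpart≼ C _≼_) ×
    ((φ χ : CFm) →
      (ClassicallyCoherent C _≼_ φ χ ⇔
        StronglyCoherent (counterpartC C) (counterpart≼ C _≼_) (φ ᵗ) (χ ᵗ)) ×
      (ClassicallyPresumptivelyValid C _≼_ φ χ ⇔
        StronglyPresumptivelyValid (counterpartC C) (counterpart≼ C _≼_) (φ ᵗ) (χ ᵗ)) ×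
      (ClassicallyConclusive C _≼_ φ χ ⇔
        StronglyConclusive (counterpartC C) (counterpart≼ C _≼_) (φ ᵗ) (χ ᵗ)))
theorem1 C _≼_ CM =
  counterpart-isQuasiClassical C _≼_ CM ,
  λ φ χ → coherent⇔stronglyCoherent C _≼_ φ χ
        , presumptivelyValid⇔stronglyPresumptivelyValid C _≼_ φ χ
        , conclusive⇔stronglyConclusive C _≼_ φ χ
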